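{- Let $n\ge 2$ and let $d\ge 2$ be even. Define $g:[n]^{d/2}\to[n^{d/2}]$ by $g(i_1,\dots,i_{d/2})=\sum_{k=1}^{d/2}(i_k-1)n^{d/2-k}+1$, and let $f$ be the homogeneous non-commutative polynomial of degree $d$ in $x_1,\dots,x_n$ $$f=\sum_{i_1,\dots,i_d\in[n]}\bigl(g(i_1,\dots,i_{d/2})-g(i_{d/2+1},\dots,i_d)\bigr)^2\,x_{i_1}x_{i_2}\cdots x_{i_d}.$$ Then $B(f)=O(d^2)$, with an absolute implicit constant.
   Context: Variables are non-commuting, so each ordered word $x_{i_1}\cdots x_{i_d}$ is a distinct monomial. An algebraic branching program (ABP) of degree $d$ is a directed acyclic graph whose vertices are partitioned into levels $0,\dots,d$, with a single source at level $0$, a single sink at level $d$, and edges only from level $i$ to level $i+1$, each edge labelled by a homogeneous linear form $\sum_i c_ix_i$ with real coefficients; it computes the sum over all source-to-sink paths of the ordered product of the edge labels. Its size is its number of vertices, and $B(f)$ is the minimum size of an ABP computing $f$. $[m]=\{1,\dots,m\}$. -}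

module Defs where

open import Data.Nat using (ℕ; zero; suc; _+_; _^_)
open import Data.Fin using (Fin; zero; suc; toℕ)
open import Data.Vec using (Vec; []; _∷_; splitAt)
open import Data.Product using (_,_)
open import Data.Integer as ℤ using (ℤ; +_)

sumℤ : ∀ {k : ℕ} → (Fin k → ℤ) → ℤ
sumℤ {zero}  f = + 0
sumℤ {suc k} f = f zero ℤ.+ sumℤ (λ i → f (suc i))

-- Chain n a d : a layered graph whose first level has a vertices, followed by
-- d layers of edges, the last level having exactly one vertex (the sink).
-- A layer between levels of widths a and b is given by the linear form on
-- each (u , v) edge: M u v x = coefficient of variable x (the zero form = no edge).
data Chain (n : ℕ) : ℕ → ℕ → Set where
  end   : Chain n 1 0
  layer : ∀ {a b d} → (Fin a → Fin b → Fin n → ℤ) → Chain n b d → Chain n a (suc d)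

ABP : ℕ → ℕ → Set
ABP n d = Chain n 1 d

size : ∀ {n a d} → Chain n a d → ℕ
size end = 1
size (layer {a = a} M c) = a + size c

-- coefficient of the (ordered) monomial x_{w1} ... x_{wd} in the polynomial
-- computed from vertex u: sum over paths of the products of edge-label coefficients
evalFrom : ∀ {n a d} → Chain n a d → Vec (Fin n) d → Fin a → ℤ
evalFrom end [] u = + 1
evalFrom (layer M c) (x ∷ w) u = sumℤ (λ v → M u v x ℤ.* evalFrom c w v)

coeff : ∀ {n d} → ABP n d → Vec (Fin n) d → ℤ
coeff A w = evalFrom A w zero

-- g(i_1..i_m) = Σ_k (i_k - 1) n^(m-k) + 1, with i_k ∈ [n] represented by Fin n (i_k - 1 = toℕ)
gsum : ∀ {n m} → Vec (Fin n) m → ℕ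
gsum []                       = 0
gsum {n} {suc m} (i ∷ is)     = toℕ i * n ^ m + gsum is
  where open Data.Nat using (_*_)

g : ∀ {n m} → Vec (Fin n) m → ℕ
g is = gsum is + 1

fcoeff : ∀ {n} (m : ℕ) → Vec (Fin n) (m + m) → ℤ
fcoeff m w with splitAt m w
... | (u , v , _) = (+ g u ℤ.- + g v) ℤ.* (+ g u ℤ.- + g v)

{-# OPTIONS --safe #-}
module Submission where

-- The coefficient of x_{w₁}⋯x_{w_d} in f is (Σₖ ℓₖ(wₖ))² for linear forms
-- ℓₖ(i) = ±(i-1)·n^(…) read off from g.  The square of such a sum is computed by
-- an ABP of width 3: the three vertices of level k compute the 0th, 1st and 2nd
-- power of the suffix sum Σ_{j>k} ℓⱼ(wⱼ), and one layer updates them by the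
-- binomial theorem.  Hence B(f) = O(d), in particular O(d²).

open import Data.Nat using (ℕ; zero; suc; _+_; _*_; _^_; _≤_; s≤s; z≤n)
import Data.Nat.Properties as ℕ
open import Data.Fin using (Fin; zero; suc; toℕ)
open import Data.Vec using (Vec; []; _∷_; _++_; map; splitAt)
open import Data.Product using (Σ; _×_; _,_)
open import Data.Integer as ℤ using (ℤ; +_; -_)
import Data.Integer.Properties as ℤ
open import Data.Integer.Solver using (module +-*-Solver)
open import Function using (_∘_)
open import Relation.Binary.PropositionalEquality
  using (_≡_; refl; sym; trans; cong; cong₂; module ≡-Reasoning)
open import Defs

open +-*-Solver

LinearForm : ℕ → Set
LinearForm n = Fin n → ℤ

linearSum : ∀ {n d} → Vec (LinearForm n) d → Vec (Fin n) d → ℤ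
linearSum []       []      = + 0
linearSum (ℓ ∷ ℓs) (x ∷ w) = ℓ x ℤ.+ linearSum ℓs w

linearSum-++ : ∀ {n k l} (ℓs : Vec (LinearForm n) k) (ℓs′ : Vec (LinearForm n) l) u v →
  linearSum (ℓs ++ ℓs′) (u ++ v) ≡ linearSum ℓs u ℤ.+ linearSum ℓs′ v
linearSum-++ []       ℓs′ []      v = sym (ℤ.+-identityˡ _)
linearSum-++ (ℓ ∷ ℓs) ℓs′ (x ∷ u) v =
  trans (cong (ℤ._+_ (ℓ x)) (linearSum-++ ℓs ℓs′ u v)) (sym (ℤ.+-assoc (ℓ x) _ _))

linearSum-neg : ∀ {n d} (ℓs : Vec (LinearForm n) d) w →
  linearSum (map (-_ ∘_) ℓs) w ≡ - linearSum ℓs w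
linearSum-neg []       []      = refl
linearSum-neg (ℓ ∷ ℓs) (x ∷ w) =
  trans (cong (ℤ._+_ (- ℓ x)) (linearSum-neg ℓs w)) (sym (ℤ.neg-distrib-+ (ℓ x) _))

sumℤ-cong : ∀ {k} {f h : Fin k → ℤ} → (∀ i → f i ≡ h i) → sumℤ f ≡ sumℤ h
sumℤ-cong {zero}  e = refl
sumℤ-cong {suc k} e = cong₂ ℤ._+_ (e zero) (sumℤ-cong (e ∘ suc))

-- Row u, column v holds the coefficient of b^v in (c + b)^u.
binomialStep : ℤ → Fin 3 → Fin 3 → ℤ
binomialStep c zero          zero          = + 1
binomialStep c zero          (suc _)       = + 0
binomialStep c (suc zero)    zero          = c
binomialStep c (suc zero)    (suc zero)    = + 1
binomialStep c (suc zero)    (suc (suc _)) = + 0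
binomialStep c (suc (suc _)) zero          = c ℤ.* c
binomialStep c (suc (suc _)) (suc zero)    = c ℤ.+ c
binomialStep c (suc (suc _)) (suc (suc _)) = + 1

binomialStep-sum : ∀ c b (u : Fin 3) →
  sumℤ (λ v → binomialStep c u v ℤ.* b ℤ.^ toℕ v) ≡ (c ℤ.+ b) ℤ.^ toℕ u
binomialStep-sum c b zero = solve 1 (λ b →
  con (+ 1) :* con (+ 1) :+ (con (+ 0) :* (b :* con (+ 1))
    :+ (con (+ 0) :* (b :* (b :* con (+ 1))) :+ con (+ 0)))
  := con (+ 1)) refl b
binomialStep-sum c b (suc zero) = solve 2 (λ c b →
  c :* con (+ 1) :+ (con (+ 1) :* (b :* con (+ 1))
    :+ (con (+ 0) :* (b :* (b :* con (+ 1))) :+ con (+ 0)))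
  := (c :+ b) :* con (+ 1)) refl c b
binomialStep-sum c b (suc (suc zero)) = solve 2 (λ c b →
  (c :* c) :* con (+ 1) :+ ((c :+ c) :* (b :* con (+ 1))
    :+ (con (+ 1) :* (b :* (b :* con (+ 1))) :+ con (+ 0)))
  := (c :+ b) :* ((c :+ b) :* con (+ 1))) refl c b

binomialStep-last : ∀ c (u : Fin 3) →
  binomialStep c u zero ℤ.* + 1 ℤ.+ + 0 ≡ (c ℤ.+ + 0) ℤ.^ toℕ u
binomialStep-last c zero             = refl
binomialStep-last c (suc zero)       =
  solve 1 (λ c → c :* con (+ 1) :+ con (+ 0) := (c :+ con (+ 0)) :* con (+ 1)) refl c
binomialStep-last c (suc (suc zero)) =
  solve 1 (λ c → (c :* c) :* con (+ 1) :+ con (+ 0)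
               := (c :+ con (+ 0)) :* ((c :+ con (+ 0)) :* con (+ 1))) refl c

-- The sink stands for the power-0 vertex after the last level: the empty sum is 0,
-- so only its 0th power survives.
powerChain : ∀ {n d} → Vec (LinearForm n) (suc d) → Chain n 3 (suc d)
powerChain {d = zero}  (ℓ ∷ [])  = layer (λ u _ x → binomialStep (ℓ x) u zero) end
powerChain {d = suc d} (ℓ ∷ ℓs)  = layer (λ u v x → binomialStep (ℓ x) u v) (powerChain ℓs)

evalFrom-powerChain : ∀ {n d} (ℓs : Vec (LinearForm n) (suc d)) w u →
  evalFrom (powerChain ℓs) w u ≡ linearSum ℓs w ℤ.^ toℕ u
evalFrom-powerChain {d = zero}  (ℓ ∷ [])  (x ∷ [])  u = binomialStep-last (ℓ x) u
evalFrom-powerChain {d = suc d} (ℓ ∷ ℓs)  (x ∷ w)   u =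
  trans (sumℤ-cong λ v → cong (ℤ._*_ (binomialStep (ℓ x) u v)) (evalFrom-powerChain ℓs w v))
        (binomialStep-sum (ℓ x) (linearSum ℓs w) u)

size-powerChain : ∀ {n d} (ℓs : Vec (LinearForm n) (suc d)) → size (powerChain ℓs) ≡ 3 * suc d + 1
size-powerChain {d = zero}  (ℓ ∷ [])  = refl
size-powerChain {d = suc d} (ℓ ∷ ℓs)  =
  trans (cong (_+_ 3) (size-powerChain ℓs)) (cong (_+ 1) (sym (ℕ.*-suc 3 (suc d))))

selectSource : ∀ {n a b d} → (Fin a → Fin b) → Chain n b (suc d) → Chain n a (suc d)
selectSource r (layer M c) = layer (M ∘ r) c

evalFrom-selectSource : ∀ {n a b d} (r : Fin a → Fin b) (C : Chain n b (suc d)) w u →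
  evalFrom (selectSource r C) w u ≡ evalFrom C w (r u)
evalFrom-selectSource r (layer M c) (x ∷ w) u = refl

size-selectSource : ∀ {n a b d} (r : Fin a → Fin b) (C : Chain n b (suc d)) →
  a ≤ b → size (selectSource r C) ≤ size C
size-selectSource r (layer M c) a≤b = ℕ.+-monoˡ-≤ (size c) a≤b

squareABP : ∀ {n d} → Vec (LinearForm n) (suc d) → ABP n (suc d)
squareABP = selectSource (λ _ → suc (suc zero)) ∘ powerChain

coeff-squareABP : ∀ {n d} (ℓs : Vec (LinearForm n) (suc d)) w →
  coeff (squareABP ℓs) w ≡ linearSum ℓs w ℤ.* linearSum ℓs w
coeff-squareABP ℓs w = begin
  coeff (squareABP ℓs) w                          ≡⟨ evalFrom-selectSource _ (powerChain ℓs) w zero ⟩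
  evalFrom (powerChain ℓs) w (suc (suc zero))     ≡⟨ evalFrom-powerChain ℓs w (suc (suc zero)) ⟩
  s ℤ.* (s ℤ.* + 1)                               ≡⟨ cong (ℤ._*_ s) (ℤ.*-identityʳ s) ⟩
  s ℤ.* s                                         ∎
  where
  open ≡-Reasoning
  s = linearSum ℓs w

size-squareABP : ∀ {n d} (ℓs : Vec (LinearForm n) (suc d)) → size (squareABP ℓs) ≤ 4 * (suc d * suc d)
size-squareABP {d = d} ℓs = begin
  size (squareABP ℓs)     ≤⟨ size-selectSource _ (powerChain ℓs) (ℕ.m≤n+m 1 2) ⟩
  size (powerChain ℓs)    ≡⟨ size-powerChain ℓs ⟩
  3 * suc d + 1           ≤⟨ ℕ.+-monoʳ-≤ (3 * suc d) (s≤s z≤n) ⟩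
  3 * suc d + suc d       ≡⟨ ℕ.+-comm (3 * suc d) (suc d) ⟩
  4 * suc d               ≤⟨ ℕ.*-monoʳ-≤ 4 (ℕ.m≤m*n (suc d) (suc d)) ⟩
  4 * (suc d * suc d)     ∎
  where open ℕ.≤-Reasoning

digitForms : ∀ n m → Vec (LinearForm n) m
digitForms n zero    = []
digitForms n (suc m) = (λ x → + (toℕ x * n ^ m)) ∷ digitForms n m

linearSum-digitForms : ∀ n m (u : Vec (Fin n) m) → linearSum (digitForms n m) u ≡ + gsum u
linearSum-digitForms n zero    []      = refl
linearSum-digitForms n (suc m) (x ∷ u) =
  trans (cong (ℤ._+_ (+ (toℕ x * n ^ m))) (linearSum-digitForms n m u))
        (sym (ℤ.pos-+ (toℕ x * n ^ m) (gsum u)))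

g-difference : ∀ {n m} (u v : Vec (Fin n) m) → + g u ℤ.- + g v ≡ + gsum u ℤ.- + gsum v
g-difference u v =
  trans (cong₂ ℤ._-_ (ℤ.pos-+ (gsum u) 1) (ℤ.pos-+ (gsum v) 1))
        (solve 2 (λ p q → (p :+ con (+ 1)) :- (q :+ con (+ 1)) := p :- q) refl (+ gsum u) (+ gsum v))

differenceForms : ∀ n m → Vec (LinearForm n) (m + m)
differenceForms n m = digitForms n m ++ map (-_ ∘_) (digitForms n m)

linearSum-differenceForms : ∀ n m (u v : Vec (Fin n) m) →
  linearSum (differenceForms n m) (u ++ v) ≡ + g u ℤ.- + g v
linearSum-differenceForms n m u v = begin
  linearSum (differenceForms n m) (u ++ v)
    ≡⟨ linearSum-++ (digitForms n m) _ u v ⟩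
  linearSum (digitForms n m) u ℤ.+ linearSum (map (-_ ∘_) (digitForms n m)) v
    ≡⟨ cong (ℤ._+_ (linearSum (digitForms n m) u)) (linearSum-neg (digitForms n m) v) ⟩
  linearSum (digitForms n m) u ℤ.- linearSum (digitForms n m) v
    ≡⟨ cong₂ ℤ._-_ (linearSum-digitForms n m u) (linearSum-digitForms n m v) ⟩
  + gsum u ℤ.- + gsum v
    ≡⟨ g-difference u v ⟨
  + g u ℤ.- + g v                                                     ∎
  where open ≡-Reasoning

coeff-differenceForms : ∀ n m (w : Vec (Fin n) (suc m + suc m)) →
  coeff (squareABP (differenceForms n (suc m))) w ≡ fcoeff (suc m) w
coeff-differenceForms n m w with splitAt (suc m) w
... | u , v , refl = trans (coeff-squareABP (differenceForms n (suc m)) (u ++ v))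
                           (cong₂ ℤ._*_ (linearSum-differenceForms n (suc m) u v) (linearSum-differenceForms n (suc m) u v))

lemma8 : Σ ℕ λ C → (n m : ℕ) → 2 ≤ n → 1 ≤ m →
    Σ (ABP n (m + m)) λ A →
      ((w : Vec (Fin n) (m + m)) → coeff A w ≡ fcoeff m w)
      × size A ≤ C * ((m + m) * (m + m))
lemma8 = 4 , λ where
  n (suc m) _ _ → squareABP (differenceForms n (suc m)) , coeff-differenceForms n m , size-squareABP (differenceForms n (suc m))
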